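{- Let $R$, $R'$, $U$ be TRSs over $\Sigma$ and $T\subseteq\mathcal{T}(\Sigma,\emptyset)$ such that $U$ is terminating relative to $R\cup R'$ on $T$. Let $\mathcal{A}=(A,[\![\cdot]\!],\ge)$ be a monotone partial model for $R\cup R'\cup U$ with $T\subseteq\mathcal{L}(\mathcal{A})$, and let $\mathcal{B}=(B,[\![\cdot]\!]_{\mathcal{B}},\succ,\sqsupseteq)$ be an extended well-founded $\mu$-monotone $\mathrm{lab}_{\mathcal{A}}(\Sigma)$-algebra for the replacement map $\mu=\mu_{\mathcal{A}}^{R\cup R'}$, such that: (1) $(B,\succ)$ is a model for $\mathrm{lab}_{\mathcal{A}}(R')$; (2) $(B,\sqsupseteq)$ is a model for $\mathrm{lab}_{\mathcal{A}}(R)$; (3) for all $f\in\Sigma$, all $\vec a_1\,a\,\vec a_2\in A^{\mathrm{ar}(f)}$ with $[\![f]\!](\vec a_1,a,\vec a_2)$ defined, all $a'\in A$ with $a\ge a'$, and all $b_1,\dots,b_{\mathrm{ar}(f)}\in B$: $[\![f^{\vec a_1 a\vec a_2}]\!]_{\mathcal{B}}(b_1,\dots,b_{\mathrm{ar}(f)})\sqsupseteq[\![f^{\vec a_1 a'\vec a_2}]\!]_{\mathcal{B}}(b_1,\dots,b_{\mathrm{ar}(f)})$. Then $U\cup R'$ is terminating relative to $R$ on $T$.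
   Context: TRS: set of rules $\ell\to r$ ($\ell\notin\mathcal{X}$, $\mathrm{Var}(r)\subseteq\mathrm{Var}(\ell)$). For relations $\to_1,\to_2$, $\to_1$ is terminating relative to $\to_2$ on $B$ if $\to_2^*\cdot\to_1\cdot\to_2^*$ admits no infinite sequence starting in $B$; for TRSs use their rewrite relations. Partial $\Sigma$-algebra $(A,[\![\cdot]\!])$: partial $[\![f]\!]:A^n\rightharpoonup A$; $[\![x]\!]_\alpha=\alpha(x)$, $[\![f(t_1,..,t_n)]\!]_\alpha=[\![f]\!]([\![t_1]\!]_\alpha,\dots)$, defined only if all subexpressions are. $\mathcal{L}(\mathcal{A})$ is the set of ground terms $t$ with $[\![t]\!]$ defined. A monotone partial model $(A,[\![\cdot]\!],\ge)$ for a TRS $P$: every $[\![f]\!]$ is closed w.r.t. $\ge$ ($f(\dots,a,\dots)$ defined and $a\ge b$ imply $f(\dots,b,\dots)$ defined) and monotone w.r.t. $\ge$ (if both defined and $a\ge b$ then $f(\dots,a,\dots)\ge f(\dots,b,\dots)$), and for all $\ell\to r\in P$, $\alpha:\mathrm{Var}(\ell)\to A$ with $[\![\ell]\!]_\alpha$ defined, $[\![\ell]\!]_\alpha\ge[\![r]\!]_\alpha$. Labelling: $\mathrm{lab}_{\mathcal{A}}(\Sigma)=\{f^\lambda\mid f\in\Sigma,\lambda\in A^{\mathrm{ar}(f)},[\![f]\!](\lambda)\text{ defined}\}$; $\mathrm{lab}_\alpha(x)=x$, $\mathrm{lab}_\alpha(f(t_1,..,t_n))=f^{([\![t_1]\!]_\alpha,..,[\![t_n]\!]_\alpha)}(\mathrm{lab}_\alpha(t_1),..,\mathrm{lab}_\alpha(t_n))$;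 $\mathrm{lab}_{\mathcal{A}}(P)=\{\mathrm{lab}_\alpha(\ell)\to\mathrm{lab}_\alpha(r)\mid\ell\to r\in P,\ \alpha:\mathrm{Var}(\ell)\to A,\ [\![\ell]\!]_\alpha\text{ defined}\}$. Core $\mathrm{core}(\mathcal{A})$: smallest $C\subseteq A$ closed under defined applications of the $[\![f]\!]$. $N_{\mathcal{A}}^{P}$: largest $N\subseteq\mathrm{core}(\mathcal{A})$ with $[\![\ell]\!]_\alpha\notin N$ for all $\ell\to r\in P$, $\alpha:\mathrm{Var}(\ell)\to\mathrm{core}(\mathcal{A})$, and $[\![f]\!](a_1,..,a_n)\notin N$ whenever all $a_j\in\mathrm{core}(\mathcal{A})$ and some $a_i\notin N$. The replacement map $\mu_{\mathcal{A}}^{P}$ on $\mathrm{lab}_{\mathcal{A}}(\Sigma)$: for $f^{(a_1,..,a_n)}$, $\mu(f^{(a_1,..,a_n)})=\{1,..,n\}\setminus\{i\mid a_i\in N_{\mathcal{A}}^P\}$. For a signature $\Sigma'$ and replacement map $\mu$ (assigning each $f$ a subset of $\{1,..,\mathrm{ar}(f)\}$), an extended well-founded $\mu$-monotone $\Sigma'$-algebra $(B,[\![\cdot]\!]_{\mathcal{B}},\succ,\sqsupseteq)$ is a total $\Sigma'$-algebra with relations $\succ,\sqsupseteq$ on $B$ such that $\succ$ is terminating relative to $\sqsupseteq$ on $B$ and each $[\![f]\!]_{\mathcal{B}}$ is $\mu$-monotone w.r.t. $\succ$ and $\sqsupseteq$: for $i\in\mu(f)$ and $a\,\rho\,b$ ($\rho\in\{\succ,\sqsupseteq\}$),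 $f(\dots,a,\dots)\,\rho\,f(\dots,b,\dots)$ with $a,b$ at position $i$. $(B,\rho)$ is a model for a TRS $P'$ over $\Sigma'$ if $[\![\ell]\!]_\beta\,\rho\,[\![r]\!]_\beta$ for all $\ell\to r\in P'$ and all $\beta:\mathrm{Var}(\ell)\to B$. -}

module Defs where

open import Data.Nat using (ℕ)
open import Data.Fin using (Fin)
open import Data.Vec using (Vec; []; _∷_; lookup; _[_]≔_)
open import Data.Vec.Relation.Unary.Any using (Any)
open import Data.Maybe using (Maybe; just; nothing; is-just; _>>=_)
open import Data.Bool using (T)
open import Data.Unit using (⊤; tt)
open import Data.Product using (Σ; ∃; _×_; _,_; proj₁; ∃-syntax; Σ-syntax)
open import Data.Sum using (_⊎_)
open import Data.Empty using (⊥)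
open import Relation.Nullary using (¬_)
open import Relation.Binary.PropositionalEquality using (_≡_; _≢_)
open import Relation.Binary.Construct.Closure.ReflexiveTransitive using (Star)
open import Induction.WellFounded using (Acc)

record Signature : Set₁ where
  field
    Sym : Set
    ar  : Sym → ℕ
open Signature public

data Term (S : Signature) (V : Set) : Set where
  var : V → Term S V
  fun : (f : Sym S) → Vec (Term S V) (ar S f) → Term S V

data _occursIn_ {S : Signature} {V : Set} (x : V) : Term S V → Set where
  here  : x occursIn var x
  there : ∀ {f ts} → Any (x occursIn_) ts → x occursIn fun f ts

mutual
  subst : ∀ {S V W} → (V → Term S W) → Term S V → Term S W
  subst σ (var x)    = σ x
  subst σ (fun f ts) = fun f (substVec σ ts)

  substVec : ∀ {S V W n} → (V → Term S W) → Vec (Term S V) n → Vec (Term S W) n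
  substVec σ []       = []
  substVec σ (t ∷ ts) = subst σ t ∷ substVec σ ts

Rule : Signature → Set
Rule S = Term S ℕ × Term S ℕ

TRS : Signature → Set₁
TRS S = Rule S → Set

IsTRS : ∀ {S} → TRS S → Set
IsTRS {S} P = ∀ l r → P (l , r) →
  (∀ x → l ≢ var x) × (∀ x → x occursIn r → x occursIn l)

_∪_ : ∀ {S} → TRS S → TRS S → TRS S
(P ∪ Q) ρ = P ρ ⊎ Q ρ

data Step {S : Signature} (P : TRS S) {V : Set} : Term S V → Term S V → Set where
  root   : ∀ {l r} → P (l , r) → (σ : ℕ → Term S V) →
           Step P (subst σ l) (subst σ r)
  inside : ∀ f (ts : Vec (Term S V) (ar S f)) (i : Fin (ar S f)) {u} →
           Step P (lookup ts i) u → Step P (fun f ts) (fun f (ts [ i ]≔ u))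

RelStep : {A : Set} → (A → A → Set) → (A → A → Set) → A → A → Set
RelStep R₁ R₂ a b = ∃[ c ] ∃[ d ] (Star R₂ a c × R₁ c d × Star R₂ d b)

-- →₁ is terminating relative to →₂ on B: every element of B is accessible
-- (no infinite →₂*·→₁·→₂* sequence starts in B, constructive reading)
TerminatingRelOn : {A : Set} → (A → A → Set) → (A → A → Set) → (A → Set) → Set
TerminatingRelOn R₁ R₂ B = ∀ a → B a → Acc (λ y x → RelStep R₁ R₂ x y) a

record PartialAlgebra (S : Signature) : Set₁ where
  field
    Carrier : Set
    ⟦_⟧     : (f : Sym S) → Vec Carrier (ar S f) → Maybe Carrier

Defined : {A : Set} → Maybe A → Set
Defined m = T (is-just m)

module _ {S : Signature} (𝒜 : PartialAlgebra S) where
  open PartialAlgebra 𝒜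

  mutual
    eval : ∀ {V} → (V → Carrier) → Term S V → Maybe Carrier
    eval α (var x)    = just (α x)
    eval α (fun f ts) = evalVec α ts >>= ⟦ f ⟧

    evalVec : ∀ {V n} → (V → Carrier) → Vec (Term S V) n → Maybe (Vec Carrier n)
    evalVec α []       = just []
    evalVec α (t ∷ ts) = eval α t >>= λ a → evalVec α ts >>= λ as → just (a ∷ as)

  InLang : Term S ⊥ → Set
  InLang t = Defined (eval (λ ()) t)

  record IsMonotonePartialModel (_≥_ : Carrier → Carrier → Set) (P : TRS S) : Set where
    field
      closed : ∀ f (as : Vec Carrier (ar S f)) (i : Fin (ar S f)) b →
               Defined (⟦ f ⟧ as) → lookup as i ≥ b → Defined (⟦ f ⟧ (as [ i ]≔ b))
      mono   : ∀ f (as : Vec Carrier (ar S f)) (i : Fin (ar S f)) b c d →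
               lookup as i ≥ b → ⟦ f ⟧ as ≡ just c → ⟦ f ⟧ (as [ i ]≔ b) ≡ just d → c ≥ d
      model  : ∀ l r → P (l , r) → (α : ℕ → Carrier) → ∀ c → eval α l ≡ just c →
               ∃[ d ] (eval α r ≡ just d × c ≥ d)

  LabSym : Set
  LabSym = Σ[ f ∈ Sym S ] Σ[ as ∈ Vec Carrier (ar S f) ] Defined (⟦ f ⟧ as)

  LabSig : Signature
  LabSig = record { Sym = LabSym ; ar = λ g → ar S (proj₁ g) }

  decDefined : {A : Set} (m : Maybe A) → Maybe (Defined m)
  decDefined (just _) = just tt
  decDefined nothing  = nothing

  mutual
    lab : ∀ {V} → (V → Carrier) → Term S V → Maybe (Term LabSig V)
    lab α (var x)    = just (var x)
    lab α (fun f ts) =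
      evalVec α ts >>= λ as →
      decDefined (⟦ f ⟧ as) >>= λ p →
      labVec α ts >>= λ ts' →
      just (fun (f , as , p) ts')

    labVec : ∀ {V n} → (V → Carrier) → Vec (Term S V) n → Maybe (Vec (Term LabSig V) n)
    labVec α []       = just []
    labVec α (t ∷ ts) = lab α t >>= λ t' → labVec α ts >>= λ ts' → just (t' ∷ ts')

  labTRS : TRS S → TRS LabSig
  labTRS P (l' , r') =
    Σ[ l ∈ Term S ℕ ] Σ[ r ∈ Term S ℕ ] Σ[ α ∈ (ℕ → Carrier) ]
      (P (l , r) × Defined (eval α l) × lab α l ≡ just l' × lab α r ≡ just r')

  data Core : Carrier → Set where
    core : ∀ f (as : Vec Carrier (ar S f)) {c} →
           (∀ i → Core (lookup as i)) → ⟦ f ⟧ as ≡ just c → Core c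

  record IsNSet (P : TRS S) (N : Carrier → Set) : Set where
    field
      ⊆core : ∀ a → N a → Core a
      noLhs : ∀ l r → P (l , r) → (α : ℕ → Carrier) → (∀ x → Core (α x)) →
              ∀ c → eval α l ≡ just c → ¬ N c
      noArg : ∀ f (as : Vec Carrier (ar S f)) c → (∀ i → Core (lookup as i)) →
              ⟦ f ⟧ as ≡ just c → ∀ i → ¬ N (lookup as i) → ¬ N c

  -- largest such N = union of all such N
  NSet : TRS S → Carrier → Set₁
  NSet P a = Σ[ N ∈ (Carrier → Set) ] (IsNSet P N × N a)

  μ : TRS S → (g : LabSym) → Fin (ar S (proj₁ g)) → Set₁
  μ P (f , as , _) i = ¬ NSet P (lookup as i)

record ExtWFMonoAlgebra (S' : Signature) (μ' : (g : Sym S') → Fin (ar S' g) → Set₁) : Set₁ where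
  field
    Carrier : Set
    ⟦_⟧     : (g : Sym S') → Vec Carrier (ar S' g) → Carrier
    _≻_     : Carrier → Carrier → Set
    _⊒_     : Carrier → Carrier → Set
    wf      : TerminatingRelOn _≻_ _⊒_ (λ _ → ⊤)
    mono≻   : ∀ g (i : Fin (ar S' g)) → μ' g i → (bs : Vec Carrier (ar S' g)) → ∀ b →
              lookup bs i ≻ b → ⟦ g ⟧ bs ≻ ⟦ g ⟧ (bs [ i ]≔ b)
    mono⊒   : ∀ g (i : Fin (ar S' g)) → μ' g i → (bs : Vec Carrier (ar S' g)) → ∀ b →
              lookup bs i ⊒ b → ⟦ g ⟧ bs ⊒ ⟦ g ⟧ (bs [ i ]≔ b)

module _ {S' : Signature} {μ' : (g : Sym S') → Fin (ar S' g) → Set₁}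
         (ℬ : ExtWFMonoAlgebra S' μ') where
  open ExtWFMonoAlgebra ℬ

  mutual
    evalB : ∀ {V} → (V → Carrier) → Term S' V → Carrier
    evalB β (var x)    = β x
    evalB β (fun g ts) = ⟦ g ⟧ (evalBVec β ts)

    evalBVec : ∀ {V n} → (V → Carrier) → Vec (Term S' V) n → Vec Carrier n
    evalBVec β []       = []
    evalBVec β (t ∷ ts) = evalB β t ∷ evalBVec β ts

  IsModelFor : (Carrier → Carrier → Set) → TRS S' → Set
  IsModelFor ρ P' = ∀ l r → P' (l , r) → (β : ℕ → Carrier) → ρ (evalB β l) (evalB β r)

LabelDecreasing : ∀ {S} (𝒜 : PartialAlgebra S) (_≥_ : PartialAlgebra.Carrier 𝒜 → PartialAlgebra.Carrier 𝒜 → Set)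
  {μ' : (g : LabSym 𝒜) → Fin (ar S (proj₁ g)) → Set₁} →
  ExtWFMonoAlgebra (LabSig 𝒜) μ' → Set
LabelDecreasing {S} 𝒜 _≥_ ℬ =
  ∀ f (as : Vec (PartialAlgebra.Carrier 𝒜) (ar S f)) (i : Fin (ar S f)) a' →
  (p : Defined (PartialAlgebra.⟦_⟧ 𝒜 f as)) → lookup as i ≥ a' →
  (p' : Defined (PartialAlgebra.⟦_⟧ 𝒜 f (as [ i ]≔ a'))) →
  (bs : Vec (ExtWFMonoAlgebra.Carrier ℬ) (ar S f)) →
  ExtWFMonoAlgebra._⊒_ ℬ (ExtWFMonoAlgebra.⟦_⟧ ℬ (f , as , p) bs)
                         (ExtWFMonoAlgebra.⟦_⟧ ℬ (f , as [ i ]≔ a' , p') bs)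

-- Interpret a ground term t ∈ L(𝒜) by a pair (a , b): its value a in 𝒜 and the value b in ℬ
-- of its labelling.  Rewriting with R ∪ R' ∪ U keeps t in L(𝒜) and decreases a with respect to ≥.
-- The position of a redex never lies below an argument whose value is in N_𝒜^{R ∪ R'}, so all
-- positions above it are μ-replacing and μ-monotonicity carries the root-step relation of ℬ up to
-- the whole term; the labels above the redex change from a to some a' with a ≥ a', which by (3)
-- costs at most ⊒.  Hence an R-step gives b ⊒* b' and an R'-step gives b (⊒* · ≻ · ⊒*) b'.  An infinite
-- (U ∪ R')-relative sequence either has infinitely many U-steps, contradicting the hypothesis on U,
-- or from some point on only R'-steps, contradicting the well-foundedness of ℬ: the proof is a
-- lexicographic induction on these two accessibility predicates.
module Submission where

open import Defs
open import Data.Empty using (⊥)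
open import Data.Nat using (ℕ)
open import Data.Fin using (Fin; zero; suc)
open import Data.Vec using (Vec; []; _∷_; lookup; _[_]≔_)
open import Data.Vec.Relation.Unary.Any using (Any; here; there)
open import Data.Vec.Properties using ([]≔-idempotent; []≔-lookup; lookup∘update)
open import Data.Maybe using (Maybe; just; nothing; maybe′; _>>=_)
open import Data.Unit using (tt)
open import Data.Product using (∃; _×_; _,_; proj₁; proj₂; ∃-syntax; Σ-syntax)
open import Data.Sum using (_⊎_; inj₁; inj₂; [_,_]′)
open import Function using (id)
open import Relation.Nullary using (¬_)
open import Relation.Binary.PropositionalEquality as ≡ using (_≡_; refl; sym; trans; cong; cong₂)
open import Relation.Binary.Construct.Closure.ReflexiveTransitive using (Star; ε; _◅_; _◅◅_; gmap)
open import Induction.WellFounded using (Acc; acc)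

>>=-just⁻ : ∀ {X Y : Set} (m : Maybe X) (k : X → Maybe Y) {y} → (m >>= k) ≡ just y →
            ∃[ x ] (m ≡ just x × k x ≡ just y)
>>=-just⁻ (just x) k e = x , refl , e
>>=-just⁻ nothing  k ()

just⇒Defined : ∀ {X : Set} {m : Maybe X} {c} → m ≡ just c → Defined m
just⇒Defined refl = tt

Defined⇒just : ∀ {X : Set} (m : Maybe X) → Defined m → ∃[ c ] (m ≡ just c)
Defined⇒just (just c) _ = c , refl
Defined⇒just nothing  ()

RelStep-map : ∀ {X Y : Set} {R₁ R₂ : X → X → Set} {S₁ S₂ : Y → Y → Set} (h : X → Y) →
              (∀ {x y} → R₁ x y → S₁ (h x) (h y)) → (∀ {x y} → R₂ x y → S₂ (h x) (h y)) →
              ∀ {x y} → RelStep R₁ R₂ x y → RelStep S₁ S₂ (h x) (h y)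
RelStep-map h f g (c , d , x↠c , c→d , d↠y) = h c , h d , gmap h g x↠c , f c→d , gmap h g d↠y

module _ {S : Signature} {P Q : TRS S} where

  IsTRS-∪ : IsTRS P → IsTRS Q → IsTRS (P ∪ Q)
  IsTRS-∪ isP isQ l r (inj₁ p) = isP l r p
  IsTRS-∪ isP isQ l r (inj₂ q) = isQ l r q

  Step-mono : ∀ {V} → (∀ {ρ} → P ρ → Q ρ) → {t u : Term S V} → Step P t u → Step Q t u
  Step-mono P⊆Q (root p σ)        = root (P⊆Q p) σ
  Step-mono P⊆Q (inside f ts i s) = inside f ts i (Step-mono P⊆Q s)

  Step-∪⁻ : ∀ {V} {t u : Term S V} → Step (P ∪ Q) t u → Step P t u ⊎ Step Q t u
  Step-∪⁻ (root (inj₁ p) σ) = inj₁ (root p σ)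
  Step-∪⁻ (root (inj₂ q) σ) = inj₂ (root q σ)
  Step-∪⁻ (inside f ts i s) with Step-∪⁻ s
  ... | inj₁ s' = inj₁ (inside f ts i s')
  ... | inj₂ s' = inj₂ (inside f ts i s')

module Replacing {S' : Signature} {μ' : (g : Sym S') → Fin (ar S' g) → Set₁}
                 (ℬ : ExtWFMonoAlgebra S' μ') where

  open ExtWFMonoAlgebra ℬ

  module _ (g : Sym S') (i : Fin (ar S' g)) (bs : Vec Carrier (ar S' g)) where

    plug : Carrier → Carrier
    plug b = ⟦ g ⟧ (bs [ i ]≔ b)

    update-mono : {_⊳_ : Carrier → Carrier → Set} →
                  (∀ cs b → lookup cs i ⊳ b → ⟦ g ⟧ cs ⊳ ⟦ g ⟧ (cs [ i ]≔ b)) →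
                  ∀ {x y} → x ⊳ y → plug x ⊳ plug y
    update-mono {_⊳_} mono {x} {y} x⊳y =
      ≡.subst (λ v → plug x ⊳ ⟦ g ⟧ v) ([]≔-idempotent bs i)
        (mono (bs [ i ]≔ x) y (≡.subst (_⊳ y) (sym (lookup∘update i bs x)) x⊳y))

    Star⊒-μ-mono : μ' g i → ∀ {b} → Star _⊒_ (lookup bs i) b →
                   Star _⊒_ (⟦ g ⟧ bs) (plug b)
    Star⊒-μ-mono i∈μ {b} s =
      ≡.subst (λ v → Star _⊒_ (⟦ g ⟧ v) (plug b)) ([]≔-lookup bs i)
        (gmap plug (update-mono {_⊒_} (mono⊒ g i i∈μ)) s)

    RelStep-μ-mono : μ' g i → ∀ {b} → RelStep _≻_ _⊒_ (lookup bs i) b →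
                     RelStep _≻_ _⊒_ (⟦ g ⟧ bs) (plug b)
    RelStep-μ-mono i∈μ {b} s =
      ≡.subst (λ v → RelStep _≻_ _⊒_ (⟦ g ⟧ v) (plug b)) ([]≔-lookup bs i)
        (RelStep-map plug (update-mono {_≻_} (mono≻ g i i∈μ)) (update-mono {_⊒_} (mono⊒ g i i∈μ)) s)

module JointEvaluation {S : Signature} (𝒜 : PartialAlgebra S)
         {μ' : (g : LabSym 𝒜) → Fin (ar S (proj₁ g)) → Set₁}
         (ℬ : ExtWFMonoAlgebra (LabSig 𝒜) μ') where

  open PartialAlgebra 𝒜 renaming (Carrier to A; ⟦_⟧ to ⟦_⟧A)
  open ExtWFMonoAlgebra ℬ renaming (Carrier to B; ⟦_⟧ to ⟦_⟧B)

  mutual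
    data Ev {V : Set} (α : V → A) (β : V → B) : Term S V → A → B → Set where
      var : ∀ x → Ev α β (var x) (α x) (β x)
      fun : ∀ {f ts as bs c} → EvVec α β ts as bs → (e : ⟦ f ⟧A as ≡ just c) →
            Ev α β (fun f ts) c (⟦ f , as , just⇒Defined e ⟧B bs)

    data EvVec {V : Set} (α : V → A) (β : V → B) :
               ∀ {n} → Vec (Term S V) n → Vec A n → Vec B n → Set where
      []  : EvVec α β [] [] []
      _∷_ : ∀ {n t a b} {ts : Vec (Term S V) n} {as bs} →
            Ev α β t a b → EvVec α β ts as bs → EvVec α β (t ∷ ts) (a ∷ as) (b ∷ bs)

  decDefined-just : ∀ {Y : Set} (m : Maybe A) {c} (e : m ≡ just c) (k : Defined m → Maybe Y) →
                    (decDefined 𝒜 m >>= k) ≡ k (just⇒Defined e)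
  decDefined-just (just c) refl k = refl

  module _ {V : Set} {α : V → A} {β : V → B} where

    Ev-lookup : ∀ {n} {ts : Vec (Term S V) n} {as bs} → EvVec α β ts as bs → (i : Fin n) →
                Ev α β (lookup ts i) (lookup as i) (lookup bs i)
    Ev-lookup (ev ∷ evs) zero    = ev
    Ev-lookup (ev ∷ evs) (suc i) = Ev-lookup evs i

    Ev-update : ∀ {n} {ts : Vec (Term S V) n} {as bs} → EvVec α β ts as bs → (i : Fin n) →
                ∀ {u a b} → Ev α β u a b → EvVec α β (ts [ i ]≔ u) (as [ i ]≔ a) (bs [ i ]≔ b)
    Ev-update (ev ∷ evs) zero    ev' = ev' ∷ evs
    Ev-update (ev ∷ evs) (suc i) ev' = ev ∷ Ev-update evs i ev'

    mutual
      Ev⇒eval : ∀ {t a b} → Ev α β t a b → eval 𝒜 α t ≡ just a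
      Ev⇒eval (var x)                = refl
      Ev⇒eval {fun f ts} (fun evs e) = trans (cong (_>>= ⟦ f ⟧A) (EvVec⇒evalVec evs)) e

      EvVec⇒evalVec : ∀ {n} {ts : Vec (Term S V) n} {as bs} → EvVec α β ts as bs →
                      evalVec 𝒜 α ts ≡ just as
      EvVec⇒evalVec []                                                = refl
      EvVec⇒evalVec (ev ∷ evs) rewrite Ev⇒eval ev | EvVec⇒evalVec evs = refl

    mutual
      eval⇒Ev : ∀ t {a} → eval 𝒜 α t ≡ just a → ∃[ b ] Ev α β t a b
      eval⇒Ev (var x) refl = β x , var x
      eval⇒Ev (fun f ts) e =
        let (as , ts⇓as , e') = >>=-just⁻ (evalVec 𝒜 α ts) ⟦ f ⟧A e
            (bs , evs)        = evalVec⇒EvVec ts ts⇓as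
        in _ , fun evs e'

      evalVec⇒EvVec : ∀ {n} (ts : Vec (Term S V) n) {as} → evalVec 𝒜 α ts ≡ just as →
                      ∃[ bs ] EvVec α β ts as bs
      evalVec⇒EvVec []       refl = [] , []
      evalVec⇒EvVec (t ∷ ts) e with >>=-just⁻ (eval 𝒜 α t) _ e
      ... | a , t⇓a , e' with >>=-just⁻ (evalVec 𝒜 α ts) _ e'
      ... | as , ts⇓as , refl =
        let (b , ev)   = eval⇒Ev t t⇓a
            (bs , evs) = evalVec⇒EvVec ts ts⇓as
        in b ∷ bs , ev ∷ evs

    mutual
      Ev⇒lab : ∀ {t a b} → Ev α β t a b → ∃[ t' ] (lab 𝒜 α t ≡ just t' × evalB ℬ β t' ≡ b)
      Ev⇒lab (var x) = var x , refl , refl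
      Ev⇒lab {fun f ts} (fun {as = as} evs e) with EvVec⇒labVec evs
      ... | ts' , labs , ts'⇓bs rewrite EvVec⇒evalVec evs =
        fun g ts' ,
        trans (decDefined-just (⟦ f ⟧A as) e _) (cong (_>>= λ us → just (fun g us)) labs) ,
        cong ⟦ g ⟧B ts'⇓bs
        where g = f , as , just⇒Defined e

      EvVec⇒labVec : ∀ {n} {ts : Vec (Term S V) n} {as bs} → EvVec α β ts as bs →
                     ∃[ ts' ] (labVec 𝒜 α ts ≡ just ts' × evalBVec ℬ β ts' ≡ bs)
      EvVec⇒labVec [] = [] , refl , refl
      EvVec⇒labVec (ev ∷ evs) with Ev⇒lab ev | EvVec⇒labVec evs
      ... | t' , lab-t , t'⇓b | ts' , lab-ts , ts'⇓bs rewrite lab-t | lab-ts =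
        t' ∷ ts' , refl , cong₂ _∷_ t'⇓b ts'⇓bs

  α₀ : ⊥ → A
  α₀ ()

  β₀ : ⊥ → B
  β₀ ()

  Ev₀ : Term S ⊥ → A → B → Set
  Ev₀ = Ev α₀ β₀

  -- Needed because distinct absurd λs (such as the one inside InLang and α₀) are not
  -- definitionally equal.
  mutual
    Ev-ground : ∀ {α : ⊥ → A} {β : ⊥ → B} {t a b} → Ev α β t a b → Ev₀ t a b
    Ev-ground (var ())
    Ev-ground (fun evs e) = fun (EvVec-ground evs) e

    EvVec-ground : ∀ {α : ⊥ → A} {β : ⊥ → B} {n} {ts : Vec (Term S ⊥) n} {as bs} →
                   EvVec α β ts as bs → EvVec α₀ β₀ ts as bs
    EvVec-ground []         = []
    EvVec-ground (ev ∷ evs) = Ev-ground ev ∷ EvVec-ground evs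

  InLang⇒Ev₀ : ∀ {t} → InLang 𝒜 t → ∃[ a ] ∃[ b ] Ev₀ t a b
  InLang⇒Ev₀ {t} t∈L =
    let (a , t⇓a) = Defined⇒just _ t∈L
        (b , ev)  = eval⇒Ev {β = β₀} t t⇓a
    in a , b , Ev-ground ev

  mutual
    Ev₀⇒Core : ∀ {t a b} → Ev₀ t a b → Core 𝒜 a
    Ev₀⇒Core (var ())
    Ev₀⇒Core (fun {f = f} {as = as} evs e) = core f as (EvVec₀⇒Core evs) e

    EvVec₀⇒Core : ∀ {n} {ts : Vec (Term S ⊥) n} {as bs} → EvVec α₀ β₀ ts as bs →
                  ∀ i → Core 𝒜 (lookup as i)
    EvVec₀⇒Core (ev ∷ evs) zero    = Ev₀⇒Core ev
    EvVec₀⇒Core (ev ∷ evs) (suc i) = EvVec₀⇒Core evs i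

  -- (a₀ , b₀) is a junk value for variables whose image under σ has no value in 𝒜.
  module Matching (σ : ℕ → Term S ⊥) (a₀ : A) (b₀ : B) where

    ασ : ℕ → A
    ασ x = maybe′ id a₀ (eval 𝒜 α₀ (σ x))

    βσ : ℕ → B
    βσ x = maybe′ (evalB ℬ β₀) b₀ (lab 𝒜 α₀ (σ x))

    ασ-Core : Core 𝒜 a₀ → ∀ x → Core 𝒜 (ασ x)
    ασ-Core a₀∈core x with eval 𝒜 α₀ (σ x) in σx⇓
    ... | just a  = Ev₀⇒Core (proj₂ (eval⇒Ev {β = β₀} (σ x) σx⇓))
    ... | nothing = a₀∈core

    Ev₀-σ : ∀ {x a b} → Ev₀ (σ x) a b → ασ x ≡ a × βσ x ≡ b
    Ev₀-σ ev with Ev⇒lab ev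
    ... | _ , lab-σx , evalB≡b rewrite Ev⇒eval ev | lab-σx = refl , evalB≡b

    mutual
      Ev-subst⁻ : ∀ (t : Term S ℕ) {a b} → Ev₀ (subst σ t) a b → Ev ασ βσ t a b
      Ev-subst⁻ (var x) ev with Ev₀-σ ev
      ... | refl , refl = var x
      Ev-subst⁻ (fun f ts) (fun evs e) = fun (EvVec-subst⁻ ts evs) e

      EvVec-subst⁻ : ∀ {n} (ts : Vec (Term S ℕ) n) {as bs} →
                     EvVec α₀ β₀ (substVec σ ts) as bs → EvVec ασ βσ ts as bs
      EvVec-subst⁻ []       []         = []
      EvVec-subst⁻ (t ∷ ts) (ev ∷ evs) = Ev-subst⁻ t ev ∷ EvVec-subst⁻ ts evs

    mutual
      Ev-subst-occurs : ∀ (t : Term S ℕ) {a b x} → Ev₀ (subst σ t) a b → x occursIn t →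
                        Ev₀ (σ x) (ασ x) (βσ x)
      Ev-subst-occurs (var x) ev here with Ev₀-σ ev
      ... | refl , refl = ev
      Ev-subst-occurs (fun f ts) (fun evs e) (there x∈ts) = EvVec-subst-occurs ts evs x∈ts

      EvVec-subst-occurs : ∀ {n} (ts : Vec (Term S ℕ) n) {as bs x} →
                           EvVec α₀ β₀ (substVec σ ts) as bs → Any (x occursIn_) ts →
                           Ev₀ (σ x) (ασ x) (βσ x)
      EvVec-subst-occurs (t ∷ ts) (ev ∷ evs) (here x∈t)   = Ev-subst-occurs t ev x∈t
      EvVec-subst-occurs (t ∷ ts) (ev ∷ evs) (there x∈ts) = EvVec-subst-occurs ts evs x∈ts

    mutual
      Ev-subst : ∀ (t : Term S ℕ) {a b} → (∀ x → x occursIn t → Ev₀ (σ x) (ασ x) (βσ x)) →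
                 Ev ασ βσ t a b → Ev₀ (subst σ t) a b
      Ev-subst (var x)    σ-ok (var .x)    = σ-ok x here
      Ev-subst (fun f ts) σ-ok (fun evs e) = fun (EvVec-subst ts (λ x p → σ-ok x (there p)) evs) e

      EvVec-subst : ∀ {n} (ts : Vec (Term S ℕ) n) {as bs} →
                    (∀ x → Any (x occursIn_) ts → Ev₀ (σ x) (ασ x) (βσ x)) →
                    EvVec ασ βσ ts as bs → EvVec α₀ β₀ (substVec σ ts) as bs
      EvVec-subst []       σ-ok []         = []
      EvVec-subst (t ∷ ts) σ-ok (ev ∷ evs) =
        Ev-subst t (λ x p → σ-ok x (here p)) ev ∷ EvVec-subst ts (λ x p → σ-ok x (there p)) evs

  -- Every position above a redex is μ-replacing.
  Step⇒∉N : ∀ {P Q : TRS S} → (∀ {ρ} → Q ρ → P ρ) →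
            ∀ {t t' a b} → Step Q t t' → Ev₀ t a b → ¬ NSet 𝒜 P a
  Step⇒∉N Q⊆P {a = a} {b} (root {l} q σ) ev (N , isN , a∈N) =
    IsNSet.noLhs isN l _ (Q⊆P q) ασ (ασ-Core (Ev₀⇒Core ev)) a (Ev⇒eval (Ev-subst⁻ l ev)) a∈N
    where open Matching σ a b
  Step⇒∉N Q⊆P (inside f ts i s) (fun {as = as} {c = c} evs e) (N , isN , c∈N) =
    IsNSet.noArg isN f as c (EvVec₀⇒Core evs) e i
      (λ ai∈N → Step⇒∉N Q⊆P s (Ev-lookup evs i) (N , isN , ai∈N)) c∈N

module Simulation {S : Signature} (P : TRS S) (isP : IsTRS P)
         (𝒜 : PartialAlgebra S) (_≥_ : PartialAlgebra.Carrier 𝒜 → PartialAlgebra.Carrier 𝒜 → Set)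
         (MP : IsMonotonePartialModel 𝒜 _≥_ P)
         {μ' : (g : LabSym 𝒜) → Fin (ar S (proj₁ g)) → Set₁}
         (ℬ : ExtWFMonoAlgebra (LabSig 𝒜) μ') where

  open PartialAlgebra 𝒜 renaming (Carrier to A; ⟦_⟧ to ⟦_⟧A)
  open ExtWFMonoAlgebra ℬ renaming (Carrier to B; ⟦_⟧ to ⟦_⟧B)
  open IsMonotonePartialModel MP
  open JointEvaluation 𝒜 ℬ

  closed-mono : ∀ f (as : Vec A (ar S f)) i {a' c} → ⟦ f ⟧A as ≡ just c → lookup as i ≥ a' →
                Σ[ c' ∈ A ] Σ[ e' ∈ ⟦ f ⟧A (as [ i ]≔ a') ≡ just c' ] (c ≥ c')
  closed-mono f as i {a'} {c} e ai≥a' =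
    let (c' , e') = Defined⇒just _ (closed f as i a' (just⇒Defined e) ai≥a')
    in c' , e' , mono f as i a' c c' ai≥a' e e'

  root-step : ∀ {l r} → P (l , r) → (σ : ℕ → Term S ⊥) → ∀ {a b} → Ev₀ (subst σ l) a b →
              Σ[ a' ∈ A ] Σ[ b' ∈ B ] (Ev₀ (subst σ r) a' b' × a ≥ a' ×
                (∀ {Q ρ} → Q (l , r) → IsModelFor ℬ ρ (labTRS 𝒜 Q) → ρ b b'))
  root-step {l} {r} p σ {a} {b} ev =
    let open Matching σ a b
        evl                  = Ev-subst⁻ l ev
        l⇓a                  = Ev⇒eval evl
        (a' , r⇓a' , a≥a')   = model l r p ασ a l⇓a
        (b' , evr)           = eval⇒Ev {β = βσ} r r⇓a'
        (l' , lab-l , l'⇓b)  = Ev⇒lab evl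
        (r' , lab-r , r'⇓b') = Ev⇒lab evr
        σ-ok : ∀ x → x occursIn r → Ev₀ (σ x) (ασ x) (βσ x)
        σ-ok x x∈r = Ev-subst-occurs l ev (proj₂ (isP l r p) x x∈r)
    in a' , b' , Ev-subst r σ-ok evr , a≥a' ,
       λ {_} {ρ} q ρ-model →
         ≡.subst₂ ρ l'⇓b r'⇓b'
           (ρ-model l' r' (l , r , ασ , q , just⇒Defined l⇓a , lab-l , lab-r) βσ)

  Ev-step : ∀ {Q} → (∀ {ρ} → Q ρ → P ρ) → ∀ {t t' a b} → Step Q t t' → Ev₀ t a b →
            Σ[ a' ∈ A ] Σ[ b' ∈ B ] (Ev₀ t' a' b' × a ≥ a')
  Ev-step Q⊆P (root q σ) ev =
    let (a' , b' , ev' , a≥a' , _) = root-step (Q⊆P q) σ ev in a' , b' , ev' , a≥a'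
  Ev-step Q⊆P (inside f ts i s) (fun {as = as} evs e) =
    let (a' , b' , ev' , ai≥a') = Ev-step Q⊆P s (Ev-lookup evs i)
        (c' , e' , c≥c')        = closed-mono f as i e ai≥a'
    in c' , _ , fun (Ev-update evs i ev') e' , c≥c'

  -- _⊳_ is ⊒* for Q = R and ≻ relative to ⊒ for Q = R'.
  module Decreasing {P' Q : TRS S} (Q⊆P : ∀ {ρ} → Q ρ → P ρ) (Q⊆P' : ∀ {ρ} → Q ρ → P' ρ)
           (LD : LabelDecreasing 𝒜 _≥_ ℬ)
           (_⊳_ : B → B → Set) (⊳-model : IsModelFor ℬ _⊳_ (labTRS 𝒜 Q))
           (⊳-μ-mono : ∀ g i bs → μ 𝒜 P' g i → ∀ {b} →
                       lookup bs i ⊳ b → ⟦ g ⟧B bs ⊳ ⟦ g ⟧B (bs [ i ]≔ b))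
           (⊳-⊒ : ∀ {x y z} → x ⊳ y → y ⊒ z → x ⊳ z) where

    Ev-step-⊳ : ∀ {t t' a b} → Step Q t t' → Ev₀ t a b →
                Σ[ a' ∈ A ] Σ[ b' ∈ B ] (Ev₀ t' a' b' × a ≥ a' × b ⊳ b')
    Ev-step-⊳ (root q σ) ev =
      let (a' , b' , ev' , a≥a' , decreasing) = root-step (Q⊆P q) σ ev
      in a' , b' , ev' , a≥a' , decreasing {ρ = _⊳_} q ⊳-model
    Ev-step-⊳ (inside f ts i s) (fun {as = as} {bs = bs} evs e) =
      let (a' , b' , ev' , ai≥a' , bi⊳b') = Ev-step-⊳ s (Ev-lookup evs i)
          (c' , e' , c≥c')              = closed-mono f as i e ai≥a'
          relabel = LD f as i a' (just⇒Defined e) ai≥a' (just⇒Defined e') (bs [ i ]≔ b')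
      in c' , _ , fun (Ev-update evs i ev') e' , c≥c' ,
         ⊳-⊒ (⊳-μ-mono _ i bs (Step⇒∉N Q⊆P' s (Ev-lookup evs i)) bi⊳b') relabel

module RelativeTermination {S : Signature} (R R' U : TRS S)
         (isR : IsTRS R) (isR' : IsTRS R') (isU : IsTRS U)
         (𝒜 : PartialAlgebra S) (_≥_ : PartialAlgebra.Carrier 𝒜 → PartialAlgebra.Carrier 𝒜 → Set)
         (MP : IsMonotonePartialModel 𝒜 _≥_ ((R ∪ R') ∪ U))
         (ℬ : ExtWFMonoAlgebra (LabSig 𝒜) (μ 𝒜 (R ∪ R')))
         (≻-model : IsModelFor ℬ (ExtWFMonoAlgebra._≻_ ℬ) (labTRS 𝒜 R'))
         (⊒-model : IsModelFor ℬ (ExtWFMonoAlgebra._⊒_ ℬ) (labTRS 𝒜 R))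
         (LD : LabelDecreasing 𝒜 _≥_ ℬ) where

  open PartialAlgebra 𝒜 renaming (Carrier to A)
  open ExtWFMonoAlgebra ℬ renaming (Carrier to B)
  open JointEvaluation 𝒜 ℬ
  open Replacing ℬ
  open Simulation ((R ∪ R') ∪ U) (IsTRS-∪ (IsTRS-∪ isR isR') isU) 𝒜 _≥_ MP ℬ

  _⊒*_ : B → B → Set
  _⊒*_ = Star _⊒_

  _≻/⊒_ : B → B → Set
  _≻/⊒_ = RelStep _≻_ _⊒_

  open Decreasing {P' = R ∪ R'} {Q = R} (λ r → inj₁ (inj₁ r)) inj₁ LD
         _⊒*_ (λ l r p β → ⊒-model l r p β ◅ ε) Star⊒-μ-mono
         (λ b⊒*c c⊒d → b⊒*c ◅◅ (c⊒d ◅ ε))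
    renaming (Ev-step-⊳ to Ev-step-R)
  open Decreasing {P' = R ∪ R'} {Q = R'} (λ r' → inj₁ (inj₂ r')) inj₂ LD
         _≻/⊒_ (λ l r p β → _ , _ , ε , ≻-model l r p β , ε) RelStep-μ-mono
         (λ (c , d , b⊒*c , c≻d , d⊒*e) e⊒f → c , d , b⊒*c , c≻d , d⊒*e ◅◅ (e⊒f ◅ ε))
    renaming (Ev-step-⊳ to Ev-step-R')

  Ev-steps-R : ∀ {t u a b} → Star (Step R) t u → Ev₀ t a b →
               Σ[ a' ∈ A ] Σ[ b' ∈ B ] (Ev₀ u a' b' × b ⊒* b')
  Ev-steps-R ε ev = _ , _ , ev , ε
  Ev-steps-R (s ◅ ss) ev =
    let (_ , _ , ev' , _ , b⊒*b')     = Ev-step-R s ev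
        (a'' , b'' , ev'' , b'⊒*b'') = Ev-steps-R ss ev'
    in a'' , b'' , ev'' , b⊒*b' ◅◅ b'⊒*b''

  Ev-relstep-U : ∀ {t u a b} → RelStep (Step U) (Step R) t u → Ev₀ t a b → ∃[ a' ] ∃[ b' ] Ev₀ u a' b'
  Ev-relstep-U (_ , _ , t↠c , c→d , d↠u) ev =
    let (_ , _ , ev₁ , _)   = Ev-steps-R t↠c ev
        (_ , _ , ev₂ , _)   = Ev-step inj₂ c→d ev₁
        (a' , b' , ev' , _) = Ev-steps-R d↠u ev₂
    in a' , b' , ev'

  Ev-relstep-R' : ∀ {t u a b} → RelStep (Step R') (Step R) t u → Ev₀ t a b →
                  Σ[ a' ∈ A ] Σ[ b' ∈ B ] (Ev₀ u a' b' × b ≻/⊒ b')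
  Ev-relstep-R' (_ , _ , t↠c , c→d , d↠u) ev =
    let (_ , _ , ev₁ , b⊒*b₁)                         = Ev-steps-R t↠c ev
        (_ , _ , ev₂ , _ , x , y , b₁⊒*x , x≻y , y⊒*b₂) = Ev-step-R' c→d ev₁
        (a' , b' , ev' , b₂⊒*b')                      = Ev-steps-R d↠u ev₂
    in a' , b' , ev' , x , y , b⊒*b₁ ◅◅ b₁⊒*x , x≻y , y⊒*b₂ ◅◅ b₂⊒*b'

  Step-R↠ : ∀ {t u : Term S ⊥} → Star (Step R) t u → Star (Step (R ∪ R')) t u
  Step-R↠ = gmap id (Step-mono inj₁)

  -- t₀ is the term after the last U-step (or the start), where the current U-free stretch begins.
  accessible : ∀ t₀ → Acc (λ y x → RelStep (Step U) (Step (R ∪ R')) x y) t₀ →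
               ∀ {t} → Star (Step (R ∪ R')) t₀ t → ∀ {a b} → Ev₀ t a b →
               Acc (λ y x → x ≻/⊒ y) b → Acc (λ y x → RelStep (Step (U ∪ R')) (Step R) x y) t
  accessible t₀ (acc U-acc) t₀↠t ev (acc ℬ-acc) = acc λ (c , d , t↠c , c→d , d↠t') →
    [ (λ c→ᵤd →
        let (_ , b' , ev') = Ev-relstep-U (c , d , t↠c , c→ᵤd , d↠t') ev
        in accessible _ (U-acc (c , d , t₀↠t ◅◅ Step-R↠ t↠c , c→ᵤd , Step-R↠ d↠t')) ε ev' (wf b' tt))
    , (λ c→d' →
        let (_ , _ , ev' , b≻/⊒b') = Ev-relstep-R' (c , d , t↠c , c→d' , d↠t') ev
        in accessible t₀ (acc U-acc) (t₀↠t ◅◅ Step-R↠ t↠c ◅◅ Step-mono inj₂ c→d' ◅ Step-R↠ d↠t') ev'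
             (ℬ-acc b≻/⊒b'))
    ]′ (Step-∪⁻ c→d)

theorem9p5 : (S : Signature) (R R' U : TRS S) →
    IsTRS R → IsTRS R' → IsTRS U →
    (Tset : Term S ⊥ → Set) →
    TerminatingRelOn (Step U) (Step (R ∪ R')) Tset →
    (𝒜 : PartialAlgebra S) (_≥_ : PartialAlgebra.Carrier 𝒜 → PartialAlgebra.Carrier 𝒜 → Set) →
    IsMonotonePartialModel 𝒜 _≥_ ((R ∪ R') ∪ U) →
    (∀ t → Tset t → InLang 𝒜 t) →
    (ℬ : ExtWFMonoAlgebra (LabSig 𝒜) (μ 𝒜 (R ∪ R'))) →
    IsModelFor ℬ (ExtWFMonoAlgebra._≻_ ℬ) (labTRS 𝒜 R') →
    IsModelFor ℬ (ExtWFMonoAlgebra._⊒_ ℬ) (labTRS 𝒜 R) →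
    LabelDecreasing 𝒜 _≥_ ℬ →
    TerminatingRelOn (Step (U ∪ R')) (Step R) Tset
theorem9p5 S R R' U isR isR' isU T U-terminating 𝒜 _≥_ MP T⊆L ℬ ≻-model ⊒-model LD t t∈T =
  let (_ , b , ev) = InLang⇒Ev₀ (T⊆L t t∈T)
  in accessible t (U-terminating t t∈T) ε ev (wf b tt)
  where
    open JointEvaluation 𝒜 ℬ using (InLang⇒Ev₀)
    open ExtWFMonoAlgebra ℬ using (wf)
    open RelativeTermination R R' U isR isR' isU 𝒜 _≥_ MP ℬ ≻-model ⊒-model LD using (accessible)
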